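{- Let $t\ge 2$ be an integer. The generating function $P_{R,F}^{(t,t)}(q)=\sum_{n\ge0} a(n)q^n$, where $a(n)$ is the number of partitions of $n$ that are both $t$-regular and $t$-flat, is $$P_{R,F}^{(t,t)}(q)=\sum_{j=0}^\infty \sum_{i=0}^j\frac{(-1)^i q^{\binom{i+1}{2}t+j-i}\,(q^{(i+1)t};q^t)_{j-i}}{(q;q)_{j-i}}.$$
   Context: A partition $\lambda_1\ge\lambda_2\ge\dots\ge\lambda_k$ is $t$-regular if no part is divisible by $t$, and $t$-flat if $\lambda_i-\lambda_{i+1}<t$ for all $1\le i<k$ and the smallest part $\lambda_k$ is less than $t$ (the empty partition is counted as a partition of $0$ with both properties). Notation: $(a;q)_n=\prod_{i=0}^{n-1}(1-aq^i)$, with $(a;q)_0=1$. -}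

module Defs where

open import Data.Nat as ℕ using (ℕ; zero; suc; _∸_; _<_; _≥_; _≤_)
open import Data.Nat.Divisibility using (_∣_; _∣?_)
open import Data.Nat.Combinatorics using (_C_)
open import Data.Integer as ℤ using (ℤ; +_; -_)
open import Data.List using (List; []; _∷_)
open import Data.Nat.ListAction using (sum)
open import Relation.Binary.PropositionalEquality using (_≡_)
open import Data.List.Relation.Unary.All using (All)
open import Data.List.Relation.Unary.Linked using (Linked)
open import Data.Product using (_×_)
open import Data.Unit using (⊤)
open import Relation.Nullary using (¬_; yes; no)
open import Relation.Nullary.Decidable using (⌊_⌋)
open import Data.Bool using (if_then_else_)

IsPartitionOf : ℕ → List ℕ → Set
IsPartitionOf n ℓ = (sum ℓ ≡ n) × All (λ x → 1 ≤ x) ℓ × Linked _≥_ ℓ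

Regular : ℕ → List ℕ → Set
Regular t ℓ = All (λ x → ¬ (t ∣ x)) ℓ

LastLess : ℕ → List ℕ → Set
LastLess t [] = ⊤
LastLess t (x ∷ []) = x < t
LastLess t (x ∷ y ∷ r) = LastLess t (y ∷ r)

Flat : ℕ → List ℕ → Set
Flat t ℓ = Linked (λ a b → a ∸ b < t) ℓ × LastLess t ℓ

RegularFlatPartition : ℕ → ℕ → List ℕ → Set
RegularFlatPartition t n ℓ = IsPartitionOf n ℓ × Regular t ℓ × Flat t ℓ

Series : Set
Series = ℕ → ℤ

sumTo : ℕ → (ℕ → ℤ) → ℤ
sumTo zero f = + 0
sumTo (suc n) f = sumTo n f ℤ.+ f n

oneS : Series
oneS zero = + 1
oneS (suc n) = + 0

mono : ℕ → Series
mono e n = if ⌊ n ℕ.≟ e ⌋ then + 1 else + 0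

_⊝_ : Series → Series → Series
(f ⊝ g) n = f n ℤ.- g n

_⊛_ : Series → Series → Series
(f ⊛ g) n = sumTo (suc n) (λ k → f k ℤ.* g (n ∸ k))

infixl 7 _⊛_
infixl 6 _⊝_

scaleS : ℤ → Series → Series
scaleS c f n = c ℤ.* f n

-- (q^c ; q^s)_m = ∏_{l<m} (1 - q^{c + s l})
qPoch : ℕ → ℕ → ℕ → Series
qPoch c s zero = oneS
qPoch c s (suc m) = qPoch c s m ⊛ (oneS ⊝ mono (c ℕ.+ s ℕ.* m))

-- 1/(1 - q^k) = Σ_{l≥0} q^{k l}   (used for k ≥ 1)
geomInv : ℕ → Series
geomInv k n = if ⌊ k ∣? n ⌋ then + 1 else + 0

-- 1/(q;q)_m = ∏_{k=1}^{m} 1/(1 - q^k)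
invQQ : ℕ → Series
invQQ zero = oneS
invQQ (suc m) = invQQ m ⊛ geomInv (suc m)

negOnePow : ℕ → ℤ
negOnePow zero = + 1
negOnePow (suc i) = - negOnePow i

summand : ℕ → ℕ → ℕ → Series
summand t i j =
  scaleS (negOnePow i) (mono (((suc i) C 2) ℕ.* t ℕ.+ (j ∸ i)))
    ⊛ qPoch ((suc i) ℕ.* t) t (j ∸ i)
    ⊛ invQQ (j ∸ i)

rhsPartial : ℕ → ℕ → Series
rhsPartial t M n = sumTo (suc M) (λ j → sumTo (suc j) (λ i → summand t i j n))

-- Let r be the residue of -b modulo t and ψ k b the coefficient of z^k in
-- (z q^r; q^t)_∞ / (z; q)_∞.  Removing the last part d of a list of k + 1 parts whose
-- differences and last part are below t, and subtracting d from the other parts, shows that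
-- the generating function F k b of such lists with no part ≡ -b (mod t) satisfies
-- F (k+1) b = Σ_{d<t, t ∤ b+d} q^((k+1)d) F k (b+d).  The functional equations of
-- (z q^c; q^t)_∞ / (z q^D; q)_∞ in c and D make (q^t;q^t)_k ψ k b satisfy the same
-- recurrence, so it equals F k b; at b = 0, expanding both q-products by Euler's formulas
-- turns it into the k-th row of the double sum.

module Submission where

open import Defs
open import Data.Nat as ℕ using (ℕ; zero; suc; _+_; _*_; _∸_; _≤_; _<_; _≥_; z≤n; s≤s)
import Data.Nat.Properties as ℕP
open import Data.Nat.Combinatorics using (_C_; nC1≡n; nCk+nC[k+1]≡[n+1]C[k+1])
open import Data.Nat.Divisibility
  using (_∣_; _∣?_; _∣0; n∣n; ∣⇒≤; >⇒∤; ∣m+n∣m⇒∣n; ∣m∸n∣n⇒∣m; ∣m∣n⇒∣m+n)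
open import Data.Nat.ListAction using (sum)
import Data.Nat.Tactic.RingSolver as ℕSolver
open import Data.Integer as ℤ using (ℤ; +_)
import Data.Integer.Properties as ℤP
import Data.Integer.Tactic.RingSolver as ℤSolver
open import Algebra.Properties.CommutativeSemigroup ℕP.+-commutativeSemigroup using (xy∙z≈xz∙y; x∙yz≈xz∙y)
open import Algebra.Properties.CommutativeSemigroup ℤP.+-commutativeSemigroup using (interchange)
open import Algebra.Properties.Ring ℤP.+-*-ring using (x[y-z]≈xy-xz)
open import Data.Bool using (if_then_else_)
open import Data.Empty using (⊥-elim)
open import Data.Unit using (tt)
open import Data.Product using (_×_; _,_; ∃-syntax; proj₁; proj₂)
open import Data.Sum using (inj₁; inj₂)
open import Data.List using (List; []; _∷_; length; map; _++_)
import Data.List.Properties as ListP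
open import Data.List.Membership.Propositional using (_∈_)
open import Data.List.Membership.Propositional.Properties using (∈-map⁺; ∈-map⁻; ∈-++⁺ˡ; ∈-++⁺ʳ; ∈-++⁻)
open import Data.List.Relation.Unary.Any using (here)
open import Data.List.Relation.Unary.All using (All; []; _∷_)
import Data.List.Relation.Unary.All as All
open import Data.List.Relation.Unary.AllPairs using ([]; _∷_)
open import Data.List.Relation.Unary.Linked using (Linked; []; [-]; _∷_)
open import Data.List.Relation.Unary.Unique.Propositional using (Unique)
import Data.List.Relation.Unary.Unique.Propositional.Properties as Unique
open import Function.Base using (_∘′_)
open import Function.Bundles using (_⇔_; mk⇔)
open import Relation.Binary.Bundles using (Setoid)
open import Relation.Binary.PropositionalEquality
open import Relation.Nullary using (Dec; yes; no; ¬_)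
open import Relation.Nullary.Decidable using (⌊_⌋)
import Relation.Binary.Reasoning.Setoid as SetoidReasoning

sumTo-cong : ∀ N {f g : ℕ → ℤ} → (∀ {k} → k < N → f k ≡ g k) → sumTo N f ≡ sumTo N g
sumTo-cong zero     f≡g = refl
sumTo-cong (suc N) f≡g = cong₂ ℤ._+_ (sumTo-cong N (λ k<N → f≡g (ℕP.m<n⇒m<1+n k<N))) (f≡g ℕP.≤-refl)

sumTo-zero : ∀ N {f : ℕ → ℤ} → (∀ {k} → k < N → f k ≡ + 0) → sumTo N f ≡ + 0
sumTo-zero zero    f≡0 = refl
sumTo-zero (suc N) f≡0
  rewrite sumTo-zero N (λ k<N → f≡0 (ℕP.m<n⇒m<1+n k<N)) | f≡0 (ℕP.n<1+n N) = refl

sumTo-+ : ∀ N (f g : ℕ → ℤ) → sumTo N (λ k → f k ℤ.+ g k) ≡ sumTo N f ℤ.+ sumTo N g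
sumTo-+ zero    f g = refl
sumTo-+ (suc N) f g rewrite sumTo-+ N f g = interchange (sumTo N f) (sumTo N g) (f N) (g N)

sumTo-neg : ∀ N (f : ℕ → ℤ) → ℤ.- sumTo N f ≡ sumTo N (λ k → ℤ.- f k)
sumTo-neg zero    f = refl
sumTo-neg (suc N) f rewrite sym (sumTo-neg N f) = ℤP.neg-distrib-+ (sumTo N f) (f N)

sumTo-sub : ∀ N (f g : ℕ → ℤ) → sumTo N (λ k → f k ℤ.- g k) ≡ sumTo N f ℤ.- sumTo N g
sumTo-sub N f g = trans (sumTo-+ N f (λ k → ℤ.- g k)) (cong (ℤ._+_ (sumTo N f)) (sym (sumTo-neg N g)))

sumTo-*ˡ : ∀ N c (f : ℕ → ℤ) → c ℤ.* sumTo N f ≡ sumTo N (λ k → c ℤ.* f k)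
sumTo-*ˡ zero    c f = ℤP.*-zeroʳ c
sumTo-*ˡ (suc N) c f rewrite sym (sumTo-*ˡ N c f) = ℤP.*-distribˡ-+ c (sumTo N f) (f N)

sumTo-*ʳ : ∀ N c (f : ℕ → ℤ) → sumTo N f ℤ.* c ≡ sumTo N (λ k → f k ℤ.* c)
sumTo-*ʳ N c f =
  trans (ℤP.*-comm (sumTo N f) c) (trans (sumTo-*ˡ N c f) (sumTo-cong N (λ {k} _ → ℤP.*-comm c (f k))))

sumTo-single : ∀ N e (f : ℕ → ℤ) → e < N → (∀ {k} → k < N → k ≢ e → f k ≡ + 0) → sumTo N f ≡ f e
sumTo-single (suc N) e f e<1+N f≡0 with e ℕ.≟ N
... | yes refl
  rewrite sumTo-zero N (λ k<N → f≡0 (ℕP.m<n⇒m<1+n k<N) (ℕP.<⇒≢ k<N)) = ℤP.+-identityˡ (f e)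
... | no e≢N
  rewrite sumTo-single N e f (ℕP.≤∧≢⇒< (ℕP.≤-pred e<1+N) e≢N) (λ k<N → f≡0 (ℕP.m<n⇒m<1+n k<N))
        | f≡0 (ℕP.n<1+n N) (e≢N ∘′ sym) = ℤP.+-identityʳ (f e)

sumTo-suc-head : ∀ N (f : ℕ → ℤ) → sumTo (suc N) f ≡ f 0 ℤ.+ sumTo N (λ k → f (suc k))
sumTo-suc-head zero    f = trans (ℤP.+-identityˡ (f 0)) (sym (ℤP.+-identityʳ (f 0)))
sumTo-suc-head (suc N) f rewrite sumTo-suc-head N f = ℤP.+-assoc (f 0) _ _

sumTo-reverse : ∀ n (f : ℕ → ℤ) → sumTo (suc n) f ≡ sumTo (suc n) (λ k → f (n ∸ k))
sumTo-reverse zero    f = refl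
sumTo-reverse (suc n) f = begin
  sumTo (suc n) f ℤ.+ f (suc n)                        ≡⟨ cong (ℤ._+ f (suc n)) (sumTo-reverse n f) ⟩
  sumTo (suc n) (λ k → f (n ∸ k)) ℤ.+ f (suc n)        ≡⟨ ℤP.+-comm _ (f (suc n)) ⟩
  f (suc n) ℤ.+ sumTo (suc n) (λ k → f (n ∸ k))        ≡⟨ sym (sumTo-suc-head (suc n) (λ k → f (suc n ∸ k))) ⟩
  sumTo (suc (suc n)) (λ k → f (suc n ∸ k))            ∎
  where open ≡-Reasoning

sumTo-swap : ∀ N M (X : ℕ → ℕ → ℤ) →
  sumTo N (λ a → sumTo M (X a)) ≡ sumTo M (λ b → sumTo N (λ a → X a b))
sumTo-swap zero    M X = sym (sumTo-zero M (λ _ → refl))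
sumTo-swap (suc N) M X rewrite sumTo-swap N M X = sym (sumTo-+ M (λ b → sumTo N (λ a → X a b)) (X N))

sumTo-telescope : ∀ N (f : ℕ → ℤ) → sumTo N (λ k → f k ℤ.- f (suc k)) ≡ f 0 ℤ.- f N
sumTo-telescope zero    f = sym (ℤP.+-inverseʳ (f 0))
sumTo-telescope (suc N) f rewrite sumTo-telescope N f = chain (f 0) (f N) (f (suc N))
  where chain : ∀ x y z → x ℤ.- y ℤ.+ (y ℤ.- z) ≡ x ℤ.- z
        chain = ℤSolver.solve-∀

sumTo-triangle : ∀ n (X : ℕ → ℕ → ℤ) →
  sumTo (suc n) (λ a → sumTo (suc (n ∸ a)) (X a)) ≡ sumTo (suc n) (λ m → sumTo (suc m) (λ a → X a (m ∸ a)))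
sumTo-triangle zero    X = refl
sumTo-triangle (suc n) X = begin
  sumTo (suc n) (λ a → sumTo (suc (suc n ∸ a)) (X a)) ℤ.+ sumTo (suc (n ∸ n)) (X (suc n))
    ≡⟨ cong₂ ℤ._+_ (sumTo-cong (suc n) (λ {a} a<1+n → row {a} (ℕP.+-∸-assoc 1 (ℕP.≤-pred a<1+n))))
                   (corner {f = X (suc n)} (ℕP.n∸n≡0 n)) ⟩
  sumTo (suc n) (λ a → sumTo (suc (n ∸ a)) (X a) ℤ.+ X a (suc n ∸ a)) ℤ.+ X (suc n) (n ∸ n)
    ≡⟨ cong (ℤ._+ X (suc n) (n ∸ n)) (sumTo-+ (suc n) _ _) ⟩
  sumTo (suc n) (λ a → sumTo (suc (n ∸ a)) (X a)) ℤ.+ sumTo (suc n) (λ a → X a (suc n ∸ a)) ℤ.+ X (suc n) (n ∸ n)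
    ≡⟨ ℤP.+-assoc (sumTo (suc n) (λ a → sumTo (suc (n ∸ a)) (X a))) (sumTo (suc n) (λ a → X a (suc n ∸ a))) _ ⟩
  sumTo (suc n) (λ a → sumTo (suc (n ∸ a)) (X a)) ℤ.+ sumTo (suc (suc n)) (λ a → X a (suc n ∸ a))
    ≡⟨ cong (ℤ._+ sumTo (suc (suc n)) (λ a → X a (suc n ∸ a))) (sumTo-triangle n X) ⟩
  sumTo (suc n) (λ m → sumTo (suc m) (λ a → X a (m ∸ a))) ℤ.+ sumTo (suc (suc n)) (λ a → X a (suc n ∸ a)) ∎
  where
  open ≡-Reasoning
  row : ∀ {a} → suc n ∸ a ≡ suc (n ∸ a) → sumTo (suc (suc n ∸ a)) (X a) ≡ sumTo (suc (n ∸ a)) (X a) ℤ.+ X a (suc n ∸ a)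
  row eq rewrite eq = refl
  corner : ∀ {m} {f : ℕ → ℤ} → m ≡ 0 → sumTo (suc m) f ≡ f m
  corner refl = ℤP.+-identityˡ _

infix 4 _≈_
record _≈_ (f g : Series) : Set where
  constructor coeffwise
  field coeff : ∀ n → f n ≡ g n
open _≈_ public

≈-setoid : Setoid _ _
≈-setoid = record
  { Carrier       = Series
  ; _≈_           = _≈_
  ; isEquivalence = record
    { refl  = coeffwise λ _ → refl
    ; sym   = λ p → coeffwise λ n → sym (coeff p n)
    ; trans = λ p q → coeffwise λ n → trans (coeff p n) (coeff q n)
    }
  }

open Setoid ≈-setoid public using () renaming (refl to ≈-refl; sym to ≈-sym; trans to ≈-trans; reflexive to ≈-reflexive)
module ≈-Reasoning = SetoidReasoning ≈-setoid

zeroS : Series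
zeroS _ = + 0

Σs : ℕ → (ℕ → Series) → Series
Σs N F n = sumTo N (λ i → F i n)

⊝-cong : ∀ {f f′ g g′} → f ≈ f′ → g ≈ g′ → f ⊝ g ≈ f′ ⊝ g′
⊝-cong p q = coeffwise λ n → cong₂ ℤ._-_ (coeff p n) (coeff q n)

⊛-cong : ∀ {f f′ g g′} → f ≈ f′ → g ≈ g′ → f ⊛ g ≈ f′ ⊛ g′
⊛-cong p q = coeffwise λ n → sumTo-cong (suc n) (λ {k} _ → cong₂ ℤ._*_ (coeff p k) (coeff q (n ∸ k)))

⊛-congˡ : ∀ f {g g′} → g ≈ g′ → f ⊛ g ≈ f ⊛ g′
⊛-congˡ f = ⊛-cong (≈-refl {f})

⊛-congʳ : ∀ {f f′} g → f ≈ f′ → f ⊛ g ≈ f′ ⊛ g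
⊛-congʳ g p = ⊛-cong p (≈-refl {g})

⊝-self : ∀ {f g} → f ≈ g → f ⊝ g ≈ zeroS
⊝-self {f} p = coeffwise λ n → trans (cong (ℤ._-_ (f n)) (sym (coeff p n))) (ℤP.+-inverseʳ (f n))

scaleS-cong : ∀ c {f g} → f ≈ g → scaleS c f ≈ scaleS c g
scaleS-cong c p = coeffwise λ n → cong (c ℤ.*_) (coeff p n)

Σs-cong : ∀ N {F G} → (∀ {i} → i < N → F i ≈ G i) → Σs N F ≈ Σs N G
Σs-cong N p = coeffwise λ n → sumTo-cong N (λ i<N → coeff (p i<N) n)

⊛-comm : ∀ f g → f ⊛ g ≈ g ⊛ f
⊛-comm f g = coeffwise λ n → trans (sumTo-reverse n _) (sumTo-cong (suc n) λ {k} k<1+n →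
  trans (cong (λ z → f (n ∸ k) ℤ.* g z) (ℕP.m∸[m∸n]≡n (ℕP.≤-pred k<1+n))) (ℤP.*-comm (f (n ∸ k)) (g k)))

⊛-assoc : ∀ f g h → (f ⊛ g) ⊛ h ≈ f ⊛ (g ⊛ h)
⊛-assoc f g h = coeffwise λ n → sym (begin
  sumTo (suc n) (λ a → f a ℤ.* sumTo (suc (n ∸ a)) (λ b → g b ℤ.* h (n ∸ a ∸ b)))
    ≡⟨ sumTo-cong (suc n) (λ {a} _ → sumTo-*ˡ (suc (n ∸ a)) (f a) _) ⟩
  sumTo (suc n) (λ a → sumTo (suc (n ∸ a)) (λ b → f a ℤ.* (g b ℤ.* h (n ∸ a ∸ b))))
    ≡⟨ sumTo-triangle n (λ a b → f a ℤ.* (g b ℤ.* h (n ∸ a ∸ b))) ⟩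
  sumTo (suc n) (λ m → sumTo (suc m) (λ a → f a ℤ.* (g (m ∸ a) ℤ.* h (n ∸ a ∸ (m ∸ a)))))
    ≡⟨ sumTo-cong (suc n) (λ {m} _ → sumTo-cong (suc m) (λ {a} a<1+m →
         trans (sym (ℤP.*-assoc (f a) _ _)) (cong (λ z → f a ℤ.* g (m ∸ a) ℤ.* h z) (∸-∸-cancel n (ℕP.≤-pred a<1+m))))) ⟩
  sumTo (suc n) (λ m → sumTo (suc m) (λ a → f a ℤ.* g (m ∸ a) ℤ.* h (n ∸ m)))
    ≡⟨ sumTo-cong (suc n) (λ {m} _ → sym (sumTo-*ʳ (suc m) (h (n ∸ m)) _)) ⟩
  ((f ⊛ g) ⊛ h) n ∎)
  where
  open ≡-Reasoning
  ∸-∸-cancel : ∀ n {a m} → a ≤ m → n ∸ a ∸ (m ∸ a) ≡ n ∸ m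
  ∸-∸-cancel n {a} {m} a≤m = trans (ℕP.∸-+-assoc n a (m ∸ a)) (cong (n ∸_) (ℕP.m+[n∸m]≡n a≤m))

⊛-identityˡ : ∀ f → oneS ⊛ f ≈ f
⊛-identityˡ f = coeffwise λ n → trans (sumTo-suc-head n _)
  (trans (cong₂ ℤ._+_ (ℤP.*-identityˡ (f n)) (sumTo-zero n (λ _ → refl))) (ℤP.+-identityʳ (f n)))

⊛-identityʳ : ∀ f → f ⊛ oneS ≈ f
⊛-identityʳ f = ≈-trans (⊛-comm f oneS) (⊛-identityˡ f)

⊛-zeroʳ : ∀ f → f ⊛ zeroS ≈ zeroS
⊛-zeroʳ f = coeffwise λ n → sumTo-zero (suc n) (λ {k} _ → ℤP.*-zeroʳ (f k))

⊛-distribˡ-⊝ : ∀ f g h → f ⊛ (g ⊝ h) ≈ f ⊛ g ⊝ f ⊛ h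
⊛-distribˡ-⊝ f g h = coeffwise λ n →
  trans (sumTo-cong (suc n) (λ {k} _ → x[y-z]≈xy-xz (f k) (g (n ∸ k)) (h (n ∸ k)))) (sumTo-sub (suc n) _ _)

⊛-distribʳ-⊝ : ∀ f g h → (g ⊝ h) ⊛ f ≈ g ⊛ f ⊝ h ⊛ f
⊛-distribʳ-⊝ f g h = ≈-trans (⊛-comm (g ⊝ h) f) (≈-trans (⊛-distribˡ-⊝ f g h) (⊝-cong (⊛-comm f g) (⊛-comm f h)))

⊛-Σs : ∀ f N F → f ⊛ Σs N F ≈ Σs N (λ i → f ⊛ F i)
⊛-Σs f N F = coeffwise λ n → trans (sumTo-cong (suc n) (λ {k} _ → sumTo-*ˡ N (f k) _)) (sumTo-swap (suc n) N _)

scaleS-⊛ˡ : ∀ c f g → scaleS c f ⊛ g ≈ scaleS c (f ⊛ g)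
scaleS-⊛ˡ c f g = coeffwise λ n →
  trans (sumTo-cong (suc n) (λ {k} _ → ℤP.*-assoc c (f k) _)) (sym (sumTo-*ˡ (suc n) c _))

scaleS-⊛ʳ : ∀ c f g → f ⊛ scaleS c g ≈ scaleS c (f ⊛ g)
scaleS-⊛ʳ c f g = ≈-trans (⊛-comm f (scaleS c g)) (≈-trans (scaleS-⊛ˡ c g f) (scaleS-cong c (⊛-comm g f)))

⊛-swap : ∀ f g h → f ⊛ (g ⊛ h) ≈ g ⊛ (f ⊛ h)
⊛-swap f g h = ≈-trans (≈-sym (⊛-assoc f g h)) (≈-trans (⊛-congʳ h (⊛-comm f g)) (⊛-assoc g f h))

⊛-interchange : ∀ a x b y → (a ⊛ x) ⊛ (b ⊛ y) ≈ (a ⊛ b) ⊛ (x ⊛ y)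
⊛-interchange a x b y =
  ≈-trans (⊛-assoc a x (b ⊛ y)) (≈-trans (⊛-congˡ a (⊛-swap x b y)) (≈-sym (⊛-assoc a b (x ⊛ y))))

unless : ∀ {P : Set} → Dec P → Series → Series
unless p f = if ⌊ p ⌋ then zeroS else f

⊛-unless : ∀ {P : Set} (p : Dec P) g f → g ⊛ unless p f ≈ unless p (g ⊛ f)
⊛-unless (yes _) g f = ⊛-zeroʳ g
⊛-unless (no  _) g f = ≈-refl

mono-≢ : ∀ {e k} → k ≢ e → mono e k ≡ + 0
mono-≢ {e} {k} k≢e with k ℕ.≟ e
... | yes k≡e = ⊥-elim (k≢e k≡e)
... | no  _   = refl

mono-≡ : ∀ e → mono e e ≡ + 1
mono-≡ e with e ℕ.≟ e
... | yes _   = refl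
... | no  e≢e = ⊥-elim (e≢e refl)

mono-indicator : ∀ {e e′ n n′} → (n ≡ e → n′ ≡ e′) → (n′ ≡ e′ → n ≡ e) → mono e n ≡ mono e′ n′
mono-indicator {e} {e′} {n} {n′} to from with n ℕ.≟ e | n′ ℕ.≟ e′
... | yes _  | yes _   = refl
... | no  _  | no  _   = refl
... | yes p  | no  ¬q  = ⊥-elim (¬q (to p))
... | no  ¬p | yes q   = ⊥-elim (¬p (from q))

mono-zero : mono 0 ≈ oneS
mono-zero = coeffwise λ { zero → refl ; (suc n) → refl }

mono-zero-⊛ : ∀ f → mono 0 ⊛ f ≈ f
mono-zero-⊛ f = ≈-trans (⊛-congʳ f mono-zero) (⊛-identityˡ f)

mono-⊛-≤ : ∀ {e n} f → e ≤ n → (mono e ⊛ f) n ≡ f (n ∸ e)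
mono-⊛-≤ {e} {n} f e≤n = begin
  (mono e ⊛ f) n             ≡⟨ sumTo-single (suc n) e _ (s≤s e≤n) (λ {k} _ k≢e → cong (ℤ._* f (n ∸ k)) (mono-≢ {e} {k} k≢e)) ⟩
  mono e e ℤ.* f (n ∸ e)     ≡⟨ cong (ℤ._* f (n ∸ e)) (mono-≡ e) ⟩
  + 1 ℤ.* f (n ∸ e)          ≡⟨ ℤP.*-identityˡ _ ⟩
  f (n ∸ e)                  ∎
  where open ≡-Reasoning

mono-⊛-> : ∀ {e n} f → n < e → (mono e ⊛ f) n ≡ + 0
mono-⊛-> {e} {n} f n<e = sumTo-zero (suc n) (λ {k} k<1+n →
  cong (ℤ._* f (n ∸ k)) (mono-≢ {e} {k} (λ { refl → ℕP.<⇒≱ n<e (ℕP.≤-pred k<1+n) })))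

mono-+ : ∀ a b → mono a ⊛ mono b ≈ mono (a + b)
mono-+ a b = coeffwise coefficient
  where
  coefficient : ∀ n → (mono a ⊛ mono b) n ≡ mono (a + b) n
  coefficient n with a ℕ.≤? n
  ... | no a≰n = trans (mono-⊛-> (mono b) (ℕP.≰⇒> a≰n)) (sym (mono-≢ {a + b} {n} λ { refl → a≰n (ℕP.m≤m+n a b) }))
  ... | yes a≤n = trans (mono-⊛-≤ (mono b) a≤n) (mono-indicator
          (λ n∸a≡b → trans (sym (ℕP.m+[n∸m]≡n a≤n)) (cong (a ℕ.+_) n∸a≡b))
          (λ n≡a+b → trans (cong (_∸ a) n≡a+b) (ℕP.m+n∸m≡n a b)))

mono-+-⊛ : ∀ a b {e} X → a + b ≡ e → mono a ⊛ (mono b ⊛ X) ≈ mono e ⊛ X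
mono-+-⊛ a b X refl = ≈-trans (≈-sym (⊛-assoc (mono a) (mono b) X)) (⊛-congʳ X (mono-+ a b))

geomInv-inverse : ∀ k → geomInv (suc k) ⊛ (oneS ⊝ mono (suc k)) ≈ oneS
geomInv-inverse k = ≈-trans (⊛-distribˡ-⊝ G oneS (mono (suc k)))
  (≈-trans (⊝-cong (⊛-identityʳ G) (⊛-comm G (mono (suc k)))) (coeffwise coefficient))
  where
  G = geomInv (suc k)
  coefficient : ∀ n → G n ℤ.- (mono (suc k) ⊛ G) n ≡ oneS n
  coefficient zero = refl
  coefficient (suc n) with suc k ℕ.≤? suc n
  ... | no k≰n rewrite mono-⊛-> G (ℕP.≰⇒> k≰n) with suc k ∣? suc n
  ...   | yes k∣n = ⊥-elim (k≰n (∣⇒≤ k∣n))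
  ...   | no  _   = refl
  coefficient (suc n) | yes k≤n rewrite mono-⊛-≤ G k≤n with suc k ∣? suc n | suc k ∣? (suc n ∸ suc k)
  ... | yes _   | yes _   = refl
  ... | no  _   | no  _   = refl
  ... | yes k∣n | no  k∤d = ⊥-elim (k∤d (∣m+n∣m⇒∣n (subst (suc k ∣_) (sym (ℕP.m+[n∸m]≡n k≤n)) k∣n) n∣n))
  ... | no  k∤n | yes k∣d = ⊥-elim (k∤n (∣m∸n∣n⇒∣m (suc k) k≤n k∣d n∣n))

geomInv-cancel : ∀ k X → X ⊛ geomInv (suc k) ⊝ mono (suc k) ⊛ (X ⊛ geomInv (suc k)) ≈ X
geomInv-cancel k X = begin
  X ⊛ G ⊝ mono (suc k) ⊛ (X ⊛ G)          ≈⟨ ⊝-cong (≈-sym (⊛-identityʳ (X ⊛ G))) (⊛-comm (mono (suc k)) (X ⊛ G)) ⟩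
  (X ⊛ G) ⊛ oneS ⊝ (X ⊛ G) ⊛ mono (suc k)  ≈⟨ ⊛-distribˡ-⊝ (X ⊛ G) oneS (mono (suc k)) ⟨
  (X ⊛ G) ⊛ (oneS ⊝ mono (suc k))          ≈⟨ ⊛-assoc X G (oneS ⊝ mono (suc k)) ⟩
  X ⊛ (G ⊛ (oneS ⊝ mono (suc k)))          ≈⟨ ⊛-congˡ X (geomInv-inverse k) ⟩
  X ⊛ oneS                                  ≈⟨ ⊛-identityʳ X ⟩
  X                                         ∎
  where
  open ≈-Reasoning
  G = geomInv (suc k)

⊝-swap : ∀ f g {h} → f ⊝ g ≈ h → f ⊝ h ≈ g
⊝-swap f g p = coeffwise λ n → trans (cong (ℤ._-_ (f n)) (sym (coeff p n))) (a-[a-b]≡b (f n) (g n))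
  where a-[a-b]≡b : ∀ a b → a ℤ.- (a ℤ.- b) ≡ b
        a-[a-b]≡b = ℤSolver.solve-∀

qPoch-split : ∀ c s i m → qPoch c s (i + m) ≈ qPoch c s i ⊛ qPoch (c + s * i) s m
qPoch-split c s i zero    = ≈-trans (≈-reflexive (cong (qPoch c s) (ℕP.+-identityʳ i))) (≈-sym (⊛-identityʳ (qPoch c s i)))
qPoch-split c s i (suc m) = begin
  qPoch c s (i + suc m)                                                  ≡⟨ cong (qPoch c s) (ℕP.+-suc i m) ⟩
  qPoch c s (i + m) ⊛ (oneS ⊝ mono (c + s * (i + m)))                    ≈⟨ ⊛-cong (qPoch-split c s i m) (≈-reflexive (cong (λ e → oneS ⊝ mono e) exponent)) ⟩
  (qPoch c s i ⊛ qPoch (c + s * i) s m) ⊛ (oneS ⊝ mono (c + s * i + s * m)) ≈⟨ ⊛-assoc (qPoch c s i) (qPoch (c + s * i) s m) (oneS ⊝ mono (c + s * i + s * m)) ⟩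
  qPoch c s i ⊛ qPoch (c + s * i) s (suc m)                               ∎
  where
  open ≈-Reasoning
  exponent : c + s * (i + m) ≡ c + s * i + s * m
  exponent = trans (cong (c ℕ.+_) (ℕP.*-distribˡ-+ s i m)) (sym (ℕP.+-assoc c (s * i) (s * m)))

C2-suc : ∀ i → suc i C 2 ≡ i + (i C 2)
C2-suc i = trans (sym (nCk+nC[k+1]≡[n+1]C[k+1] i 1)) (cong (_+ (i C 2)) (nC1≡n i))

concatUpTo : ∀ {A : Set} → (ℕ → List A) → ℕ → List A
concatUpTo f zero    = []
concatUpTo f (suc D) = concatUpTo f D ++ f D

module _ {A : Set} (f : ℕ → List A) where

  ∈-concatUpTo⁻ : ∀ D {x} → x ∈ concatUpTo f D → ∃[ d ] (d < D × x ∈ f d)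
  ∈-concatUpTo⁻ (suc D) x∈ with ∈-++⁻ (concatUpTo f D) x∈
  ... | inj₂ x∈f[D] = D , ℕP.n<1+n D , x∈f[D]
  ... | inj₁ x∈init with ∈-concatUpTo⁻ D x∈init
  ...   | d , d<D , x∈f[d] = d , ℕP.m<n⇒m<1+n d<D , x∈f[d]

  ∈-concatUpTo⁺ : ∀ {D d x} → d < D → x ∈ f d → x ∈ concatUpTo f D
  ∈-concatUpTo⁺ {suc D} {d} d<1+D x∈f[d] with d ℕ.≟ D
  ... | yes refl = ∈-++⁺ʳ (concatUpTo f d) x∈f[d]
  ... | no  d≢D  = ∈-++⁺ˡ (∈-concatUpTo⁺ (ℕP.≤∧≢⇒< (ℕP.≤-pred d<1+D) d≢D) x∈f[d])

  concatUpTo-unique : (label : A → ℕ) → (∀ {d x} → x ∈ f d → label x ≡ d) →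
                      (∀ d → Unique (f d)) → ∀ D → Unique (concatUpTo f D)
  concatUpTo-unique label labelled unique zero    = []
  concatUpTo-unique label labelled unique (suc D) =
    Unique.++⁺ (concatUpTo-unique label labelled unique D) (unique D) λ (x∈init , x∈f[D]) →
      let (d , d<D , x∈f[d]) = ∈-concatUpTo⁻ D x∈init
      in ℕP.<⇒≢ d<D (trans (sym (labelled x∈f[d])) (labelled x∈f[D]))

  length-concatUpTo : ∀ D → + length (concatUpTo f D) ≡ sumTo D (λ d → + length (f d))
  length-concatUpTo zero    = refl
  length-concatUpTo (suc D) = begin
    + length (concatUpTo f D ++ f D)                 ≡⟨ cong +_ (ListP.length-++ (concatUpTo f D)) ⟩
    + (length (concatUpTo f D) + length (f D))       ≡⟨ ℤP.pos-+ (length (concatUpTo f D)) (length (f D)) ⟩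
    + length (concatUpTo f D) ℤ.+ + length (f D)     ≡⟨ cong (ℤ._+ + length (f D)) (length-concatUpTo D) ⟩
    sumTo (suc D) (λ d → + length (f d))             ∎
    where open ≡-Reasoning

unlessL : ∀ {P A : Set} → Dec P → List A → List A
unlessL p xs = if ⌊ p ⌋ then [] else xs

whenL : ∀ {P A : Set} → Dec P → List A → List A
whenL p xs = if ⌊ p ⌋ then xs else []

module _ {P A : Set} where

  ∈-unlessL⁻ : ∀ (p : Dec P) {xs} {x : A} → x ∈ unlessL p xs → ¬ P × x ∈ xs
  ∈-unlessL⁻ (no ¬x) x∈ = ¬x , x∈

  ∈-unlessL⁺ : ∀ (p : Dec P) {xs} {x : A} → ¬ P → x ∈ xs → x ∈ unlessL p xs
  ∈-unlessL⁺ (yes x) ¬x _  = ⊥-elim (¬x x)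
  ∈-unlessL⁺ (no  _) _  x∈ = x∈

  ∈-whenL⁻ : ∀ (p : Dec P) {xs} {x : A} → x ∈ whenL p xs → P × x ∈ xs
  ∈-whenL⁻ (yes x) x∈ = x , x∈

  ∈-whenL⁺ : ∀ (p : Dec P) {xs} {x : A} → P → x ∈ xs → x ∈ whenL p xs
  ∈-whenL⁺ (yes _) _ x∈ = x∈
  ∈-whenL⁺ (no ¬x) x _  = ⊥-elim (¬x x)

  unlessL-unique : ∀ (p : Dec P) {xs : List A} → Unique xs → Unique (unlessL p xs)
  unlessL-unique (yes _) _  = []
  unlessL-unique (no  _) ux = ux

  whenL-unique : ∀ (p : Dec P) {xs : List A} → Unique xs → Unique (whenL p xs)
  whenL-unique (yes _) ux = ux
  whenL-unique (no  _) _  = []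

  length-unlessL : ∀ (p : Dec P) {xs : List A} {f n} → + length xs ≡ f n → + length (unlessL p xs) ≡ unless p f n
  length-unlessL (yes _) _   = refl
  length-unlessL (no  _) len = len

length-whenL-mono : ∀ {A : Set} {e n} (p : Dec (e ≤ n)) {xs : List A} {F} →
                    + length xs ≡ F (n ∸ e) → + length (whenL p xs) ≡ (mono e ⊛ F) n
length-whenL-mono (yes e≤n) {F = F} len = trans len (sym (mono-⊛-≤ F e≤n))
length-whenL-mono (no  e≰n) {F = F} _   = sym (mono-⊛-> F (ℕP.≰⇒> e≰n))

grow : ℕ → List ℕ → List ℕ
grow d []       = d ∷ []
grow d (y ∷ ys) = y + d ∷ grow d ys

lastPart : List ℕ → ℕ
lastPart []          = 0
lastPart (x ∷ [])    = x
lastPart (x ∷ y ∷ r) = lastPart (y ∷ r)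

lower : ℕ → List ℕ → List ℕ
lower d []          = []
lower d (x ∷ [])    = []
lower d (x ∷ y ∷ r) = x ∸ d ∷ lower d (y ∷ r)

length-grow : ∀ d ν → length (grow d ν) ≡ suc (length ν)
length-grow d []      = refl
length-grow d (y ∷ ν) = cong suc (length-grow d ν)

sum-grow : ∀ d ν → sum (grow d ν) ≡ suc (length ν) * d + sum ν
sum-grow d []      = sym (ℕP.+-identityʳ (d + 0))
sum-grow d (y ∷ ν) rewrite sum-grow d ν = identity y d (length ν) (sum ν)
  where identity : ∀ y d l s → y + d + (suc l * d + s) ≡ suc (suc l) * d + (y + s)
        identity = ℕSolver.solve-∀

lastPart-grow : ∀ d ν → lastPart (grow d ν) ≡ d
lastPart-grow d []          = refl
lastPart-grow d (y ∷ [])    = refl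
lastPart-grow d (y ∷ z ∷ ν) = lastPart-grow d (z ∷ ν)

grow-injective : ∀ d {ν ν′} → grow d ν ≡ grow d ν′ → ν ≡ ν′
grow-injective d {[]}    {[]}     _  = refl
grow-injective d {[]}    {_ ∷ []} ()
grow-injective d {[]}    {_ ∷ _ ∷ _} ()
grow-injective d {_ ∷ []} {[]}    ()
grow-injective d {_ ∷ _ ∷ _} {[]} ()
grow-injective d {y ∷ ν} {y′ ∷ ν′} eq =
  cong₂ _∷_ (ℕP.+-cancelʳ-≡ d y y′ (ListP.∷-injectiveˡ eq)) (grow-injective d (ListP.∷-injectiveʳ eq))

lastPart-≤ : ∀ {x r} → Linked _≥_ (x ∷ r) → lastPart (x ∷ r) ≤ x
lastPart-≤ {r = []}    _          = ℕP.≤-refl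
lastPart-≤ {r = _ ∷ _} (y≤x ∷ ys) = ℕP.≤-trans (lastPart-≤ ys) y≤x

grow-lower : ∀ {x r} → Linked _≥_ (x ∷ r) → x ∷ r ≡ grow (lastPart (x ∷ r)) (lower (lastPart (x ∷ r)) (x ∷ r))
grow-lower {r = []}    _            = refl
grow-lower {r = _ ∷ _} xs@(y≤x ∷ ys) =
  cong₂ _∷_ (sym (ℕP.m∸n+n≡m (ℕP.≤-trans (lastPart-≤ ys) y≤x))) (grow-lower ys)

All-grow⁺ : ∀ {P : ℕ → Set} {d ν} → All (λ y → P (y + d)) ν → P d → All P (grow d ν)
All-grow⁺ []         pd = pd ∷ []
All-grow⁺ (py ∷ pys) pd = py ∷ All-grow⁺ pys pd

All-grow⁻ : ∀ {P : ℕ → Set} {d} ν → All P (grow d ν) → All (λ y → P (y + d)) ν × P d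
All-grow⁻ []      (pd ∷ [])  = [] , pd
All-grow⁻ (y ∷ ν) (py ∷ pys) = let (pν , pd) = All-grow⁻ ν pys in py ∷ pν , pd

length≤sum : ∀ {ℓ} → All (1 ≤_) ℓ → length ℓ ≤ sum ℓ
length≤sum []         = z≤n
length≤sum (1≤x ∷ xs) = ℕP.+-mono-≤ 1≤x (length≤sum xs)

Linked-≥-grow⁺ : ∀ d {ν} → Linked _≥_ ν → Linked _≥_ (grow d ν)
Linked-≥-grow⁺ d []          = [-]
Linked-≥-grow⁺ d {y ∷ []} [-] = ℕP.m≤n+m d y ∷ [-]
Linked-≥-grow⁺ d (z≤y ∷ ys)  = ℕP.+-monoˡ-≤ d z≤y ∷ Linked-≥-grow⁺ d ys

Linked-≥-grow⁻ : ∀ d {ν} → Linked _≥_ (grow d ν) → Linked _≥_ ν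
Linked-≥-grow⁻ d {[]}        _          = []
Linked-≥-grow⁻ d {y ∷ []}    _          = [-]
Linked-≥-grow⁻ d {y ∷ z ∷ ν} (z≤y ∷ ys) = ℕP.+-cancelʳ-≤ d z y z≤y ∷ Linked-≥-grow⁻ d ys

[m+o]∸[n+o]≡m∸n : ∀ m n o → m + o ∸ (n + o) ≡ m ∸ n
[m+o]∸[n+o]≡m∸n m n o = trans (cong₂ _∸_ (ℕP.+-comm m o) (ℕP.+-comm n o)) (ℕP.[m+n]∸[m+o]≡n∸o o m n)

Flat-grow⁺ : ∀ {t d ν} → Flat t ν → d < t → Flat t (grow d ν)
Flat-grow⁺ {ν = []}        _             d<t = [-] , d<t
Flat-grow⁺ {t} {d} {y ∷ []} (_ , y<t)   d<t = subst (_< t) (sym (ℕP.m+n∸n≡m y d)) y<t ∷ [-] , d<t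
Flat-grow⁺ {t} {d} {y ∷ z ∷ ν} (y∸z<t ∷ zs , last) d<t =
  let (grown , last′) = Flat-grow⁺ (zs , last) d<t
  in subst (_< t) (sym ([m+o]∸[n+o]≡m∸n y z d)) y∸z<t ∷ grown , last′

Flat-grow⁻ : ∀ {t d ν} → Flat t (grow d ν) → Flat t ν × d < t
Flat-grow⁻ {ν = []}          (_ , d<t)                 = ([] , tt) , d<t
Flat-grow⁻ {t} {d} {y ∷ []}  (y+d∸d<t ∷ [-] , d<t)     = ([-] , subst (_< t) (ℕP.m+n∸n≡m y d) y+d∸d<t) , d<t
Flat-grow⁻ {t} {d} {y ∷ z ∷ ν} (y∸z<t ∷ zs , last) =
  let ((shrunk , last′) , d<t) = Flat-grow⁻ (zs , last)
  in (subst (_< t) ([m+o]∸[n+o]≡m∸n y z d) y∸z<t ∷ shrunk , last′) , d<t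

module _ (u : ℕ) where

  private
    t : ℕ
    t = suc u

  invQtQt : ℕ → Series
  invQtQt zero    = oneS
  invQtQt (suc i) = invQtQt i ⊛ geomInv (t + t * i)

  -- Euler's expansions (z q^c; q^t)_∞ = Σ_i α c i z^i and 1/(z q^D; q)_∞ = Σ_m β D m z^m,
  -- so zCoeff c D k is the coefficient of z^k in (z q^c; q^t)_∞ / (z q^D; q)_∞
  α : ℕ → ℕ → Series
  α c i = scaleS (negOnePow i) (mono ((i C 2) * t + c * i) ⊛ invQtQt i)

  β : ℕ → ℕ → Series
  β D m = mono (D * m) ⊛ invQQ m

  zCoeff : ℕ → ℕ → ℕ → Series
  zCoeff c D k = Σs (suc k) (λ i → α c i ⊛ β D (k ∸ i))

  α-zero : ∀ c → α c 0 ≈ oneS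
  α-zero c = coeffwise λ n → trans (ℤP.*-identityˡ _)
    (coeff (≈-trans (⊛-identityʳ _) (≈-trans (≈-reflexive (cong mono (ℕP.*-zeroʳ c))) mono-zero)) n)

  β-zero : ∀ D → β D 0 ≈ oneS
  β-zero D = ≈-trans (⊛-identityʳ _) (≈-trans (≈-reflexive (cong mono (ℕP.*-zeroʳ D))) mono-zero)

  zCoeff-zero : ∀ c D → zCoeff c D 0 ≈ oneS
  zCoeff-zero c D = coeffwise λ n →
    trans (ℤP.+-identityˡ _) (coeff (≈-trans (⊛-cong (α-zero c) (β-zero D)) (⊛-identityˡ oneS)) n)

  β-step : ∀ D m → β D (suc m) ⊝ mono D ⊛ β D m ≈ β (suc D) (suc m)
  β-step D m = begin
    β D (suc m) ⊝ mono D ⊛ β D m               ≈⟨ ⊝-cong (≈-refl {β D (suc m)}) (mono-+-⊛ D (D * m) (invQQ m) (sym (ℕP.*-suc D m))) ⟩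
    mono E ⊛ invQQ (suc m) ⊝ mono E ⊛ invQQ m   ≈⟨ ⊛-distribˡ-⊝ (mono E) (invQQ (suc m)) (invQQ m) ⟨
    mono E ⊛ (invQQ (suc m) ⊝ invQQ m)          ≈⟨ ⊛-congˡ (mono E) (⊝-swap (invQQ (suc m)) (mono (suc m) ⊛ invQQ (suc m)) (geomInv-cancel m (invQQ m))) ⟩
    mono E ⊛ (mono (suc m) ⊛ invQQ (suc m))     ≈⟨ mono-+-⊛ E (suc m) (invQQ (suc m)) (ℕP.+-comm E (suc m)) ⟩
    β (suc D) (suc m)                           ∎
    where
    open ≈-Reasoning
    E = D * suc m

  -- (z q^c; q^t)_∞ = (1 - z q^c) (z q^(c+t); q^t)_∞
  α-step : ∀ c i → α c (suc i) ≈ α (c + t) (suc i) ⊝ mono c ⊛ α (c + t) i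
  α-step c i = coeffwise λ n → trans (sym (-σy-σ[x-y]≡-σx σ (x n) (y n)))
    (cong₂ ℤ._-_ (cong (ℤ.- σ ℤ.*_) (coeff (mono-+-⊛ E₀ K P′ E₀+K≡E₁) n)) (sym (coeff shifted n)))
    where
    σ  = negOnePow i
    K  = t + t * i
    P′ = invQtQt (suc i)
    E₀ = (suc i C 2) * t + c * suc i
    E₁ = (suc i C 2) * t + (c + t) * suc i
    E₂ = (i C 2) * t + (c + t) * i
    x  = mono E₀ ⊛ P′
    y  = mono E₀ ⊛ (mono K ⊛ P′)
    -σy-σ[x-y]≡-σx : ∀ σ x y → ℤ.- σ ℤ.* y ℤ.- σ ℤ.* (x ℤ.- y) ≡ ℤ.- σ ℤ.* x
    -σy-σ[x-y]≡-σx = ℤSolver.solve-∀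
    E₀+K≡E₁ : E₀ + K ≡ E₁
    E₀+K≡E₁ = identity ((suc i C 2) * t) c i u
      where identity : ∀ X c i u → X + c * suc i + (suc u + suc u * i) ≡ X + (c + suc u) * suc i
            identity = ℕSolver.solve-∀
    c+E₂≡E₀ : c + E₂ ≡ E₀
    c+E₂≡E₀ rewrite C2-suc i = identity (i C 2) c i u
      where identity : ∀ Y c i u → c + (Y * suc u + (c + suc u) * i) ≡ (i + Y) * suc u + c * suc i
            identity = ℕSolver.solve-∀
    shifted : mono c ⊛ α (c + t) i ≈ scaleS σ (x ⊝ y)
    shifted = begin
      mono c ⊛ α (c + t) i                   ≈⟨ scaleS-⊛ʳ σ (mono c) (mono E₂ ⊛ invQtQt i) ⟩
      scaleS σ (mono c ⊛ (mono E₂ ⊛ invQtQt i)) ≈⟨ scaleS-cong σ (mono-+-⊛ c E₂ (invQtQt i) c+E₂≡E₀) ⟩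
      scaleS σ (mono E₀ ⊛ invQtQt i)           ≈⟨ scaleS-cong σ (⊛-congˡ (mono E₀) (≈-sym (geomInv-cancel (u + t * i) (invQtQt i)))) ⟩
      scaleS σ (mono E₀ ⊛ (P′ ⊝ mono K ⊛ P′))  ≈⟨ scaleS-cong σ (⊛-distribˡ-⊝ (mono E₀) P′ (mono K ⊛ P′)) ⟩
      scaleS σ (x ⊝ y)                          ∎
      where open ≈-Reasoning

  ⊛-β-step : ∀ f D m → f ⊛ β D (suc m) ⊝ mono D ⊛ (f ⊛ β D m) ≈ f ⊛ β (suc D) (suc m)
  ⊛-β-step f D m = begin
    f ⊛ β D (suc m) ⊝ mono D ⊛ (f ⊛ β D m)   ≈⟨ ⊝-cong (≈-refl {f ⊛ β D (suc m)}) (⊛-swap (mono D) f (β D m)) ⟩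
    f ⊛ β D (suc m) ⊝ f ⊛ (mono D ⊛ β D m)   ≈⟨ ⊛-distribˡ-⊝ f (β D (suc m)) (mono D ⊛ β D m) ⟨
    f ⊛ (β D (suc m) ⊝ mono D ⊛ β D m)       ≈⟨ ⊛-congˡ f (β-step D m) ⟩
    f ⊛ β (suc D) (suc m)                     ∎
    where open ≈-Reasoning

  -- (1 - z q^D) / (z q^D; q)_∞ = 1 / (z q^(D+1); q)_∞
  zCoeff-sucD : ∀ c D k → zCoeff c D (suc k) ⊝ mono D ⊛ zCoeff c D k ≈ zCoeff c (suc D) (suc k)
  zCoeff-sucD c D k = coeffwise λ n → begin
    sumTo (suc k) (A n) ℤ.+ Z n ℤ.- (mono D ⊛ zCoeff c D k) n
      ≡⟨ cong (ℤ._-_ (sumTo (suc k) (A n) ℤ.+ Z n)) (coeff (⊛-Σs (mono D) (suc k) (λ i → α c i ⊛ β D (k ∸ i))) n) ⟩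
    sumTo (suc k) (A n) ℤ.+ Z n ℤ.- sumTo (suc k) (B n)
      ≡⟨ [a+b]-c≡[a-c]+b (sumTo (suc k) (A n)) (Z n) (sumTo (suc k) (B n)) ⟩
    sumTo (suc k) (A n) ℤ.- sumTo (suc k) (B n) ℤ.+ Z n
      ≡⟨ cong (ℤ._+ Z n) (sym (sumTo-sub (suc k) (A n) (B n))) ⟩
    sumTo (suc k) (λ i → A n i ℤ.- B n i) ℤ.+ Z n
      ≡⟨ cong₂ ℤ._+_ (sumTo-cong (suc k) (λ i<1+k → coeff (term i<1+k) n)) (coeff (⊛-congˡ (α c (suc k)) corner) n) ⟩
    zCoeff c (suc D) (suc k) n ∎
    where
    open ≡-Reasoning
    A B : ℕ → ℕ → ℤ
    A n i = (α c i ⊛ β D (suc k ∸ i)) n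
    B n i = (mono D ⊛ (α c i ⊛ β D (k ∸ i))) n
    Z : ℕ → ℤ
    Z n = (α c (suc k) ⊛ β D (k ∸ k)) n
    [a+b]-c≡[a-c]+b : ∀ a b c → a ℤ.+ b ℤ.- c ≡ a ℤ.- c ℤ.+ b
    [a+b]-c≡[a-c]+b = ℤSolver.solve-∀
    corner : β D (k ∸ k) ≈ β (suc D) (k ∸ k)
    corner rewrite ℕP.n∸n≡0 k = ≈-trans (β-zero D) (≈-sym (β-zero (suc D)))
    term : ∀ {i} → i < suc k → α c i ⊛ β D (suc k ∸ i) ⊝ mono D ⊛ (α c i ⊛ β D (k ∸ i)) ≈ α c i ⊛ β (suc D) (suc k ∸ i)
    term {i} i<1+k rewrite ℕP.+-∸-assoc 1 (ℕP.≤-pred i<1+k) = ⊛-β-step (α c i) D (k ∸ i)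

  ⊛-α-step : ∀ c i f → α c (suc i) ⊛ f ≈ α (c + t) (suc i) ⊛ f ⊝ mono c ⊛ (α (c + t) i ⊛ f)
  ⊛-α-step c i f = begin
    α c (suc i) ⊛ f                                            ≈⟨ ⊛-congʳ f (α-step c i) ⟩
    (α (c + t) (suc i) ⊝ mono c ⊛ α (c + t) i) ⊛ f             ≈⟨ ⊛-distribʳ-⊝ f (α (c + t) (suc i)) (mono c ⊛ α (c + t) i) ⟩
    α (c + t) (suc i) ⊛ f ⊝ (mono c ⊛ α (c + t) i) ⊛ f         ≈⟨ ⊝-cong (≈-refl {α (c + t) (suc i) ⊛ f}) (⊛-assoc (mono c) (α (c + t) i) f) ⟩
    α (c + t) (suc i) ⊛ f ⊝ mono c ⊛ (α (c + t) i ⊛ f)         ∎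
    where open ≈-Reasoning

  -- both sides are (z q^(D+t); q^t)_∞ / (z q^(D+1); q)_∞ after cancelling 1 - z q^D
  zCoeff-cancel : ∀ D k → zCoeff D D k ≈ zCoeff (D + t) (suc D) k
  zCoeff-cancel D zero    = ≈-trans (zCoeff-zero D D) (≈-sym (zCoeff-zero (D + t) (suc D)))
  zCoeff-cancel D (suc k) = ≈-trans (coeffwise expand) (zCoeff-sucD D′ D k)
    where
    D′ = D + t
    expand : ∀ n → zCoeff D D (suc k) n ≡ (zCoeff D′ D (suc k) ⊝ mono D ⊛ zCoeff D′ D k) n
    expand n = begin
      zCoeff D D (suc k) n
        ≡⟨ sumTo-suc-head (suc k) _ ⟩
      (α D 0 ⊛ β D (suc k)) n ℤ.+ sumTo (suc k) (λ i → (α D (suc i) ⊛ β D (k ∸ i)) n)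
        ≡⟨ cong₂ ℤ._+_ (coeff (⊛-congʳ (β D (suc k)) (≈-trans (α-zero D) (≈-sym (α-zero D′)))) n)
                       (sumTo-cong (suc k) (λ {i} _ → coeff (⊛-α-step D i (β D (k ∸ i))) n)) ⟩
      Z ℤ.+ sumTo (suc k) (λ i → X i ℤ.- Y i)
        ≡⟨ cong (ℤ._+_ Z) (sumTo-sub (suc k) X Y) ⟩
      Z ℤ.+ (sumTo (suc k) X ℤ.- sumTo (suc k) Y)
        ≡⟨ ℤP.+-assoc Z (sumTo (suc k) X) (ℤ.- sumTo (suc k) Y) ⟨
      Z ℤ.+ sumTo (suc k) X ℤ.- sumTo (suc k) Y
        ≡⟨ cong₂ ℤ._-_ (sumTo-suc-head (suc k) (λ i → (α D′ i ⊛ β D (suc k ∸ i)) n))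
                       (coeff (⊛-Σs (mono D) (suc k) (λ i → α D′ i ⊛ β D (k ∸ i))) n) ⟨
      (zCoeff D′ D (suc k) ⊝ mono D ⊛ zCoeff D′ D k) n ∎
      where
      open ≡-Reasoning
      Z : ℤ
      Z = (α D′ 0 ⊛ β D (suc k)) n
      X Y : ℕ → ℤ
      X i = (α D′ (suc i) ⊛ β D (k ∸ i)) n
      Y i = (mono D ⊛ (α D′ i ⊛ β D (k ∸ i))) n

  α-shift : ∀ c e i → α (c + e) i ≈ mono (e * i) ⊛ α c i
  α-shift c e i = ≈-sym (≈-trans (scaleS-⊛ʳ (negOnePow i) (mono (e * i)) (mono ((i C 2) * t + c * i) ⊛ invQtQt i))
    (scaleS-cong (negOnePow i) (mono-+-⊛ (e * i) ((i C 2) * t + c * i) (invQtQt i) (identity ((i C 2) * t) c e i))))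
    where identity : ∀ X c e i → e * i + (X + c * i) ≡ X + (c + e) * i
          identity = ℕSolver.solve-∀

  β-shift : ∀ D e m → β (D + e) m ≈ mono (e * m) ⊛ β D m
  β-shift D e m = ≈-sym (mono-+-⊛ (e * m) (D * m) (invQQ m) (identity D e m))
    where identity : ∀ D e m → e * m + D * m ≡ (D + e) * m
          identity = ℕSolver.solve-∀

  -- substitution z ↦ z q^e
  zCoeff-shift : ∀ c D e k → zCoeff (c + e) (D + e) k ≈ mono (e * k) ⊛ zCoeff c D k
  zCoeff-shift c D e k =
    ≈-trans (Σs-cong (suc k) (λ i<1+k → term (ℕP.≤-pred i<1+k))) (≈-sym (⊛-Σs (mono (e * k)) (suc k) (λ i → α c i ⊛ β D (k ∸ i))))
    where
    term : ∀ {i} → i ≤ k → α (c + e) i ⊛ β (D + e) (k ∸ i) ≈ mono (e * k) ⊛ (α c i ⊛ β D (k ∸ i))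
    term {i} i≤k = begin
      α (c + e) i ⊛ β (D + e) (k ∸ i)                                ≈⟨ ⊛-cong (α-shift c e i) (β-shift D e (k ∸ i)) ⟩
      (mono (e * i) ⊛ α c i) ⊛ (mono (e * (k ∸ i)) ⊛ β D (k ∸ i))    ≈⟨ ⊛-interchange (mono (e * i)) (α c i) (mono (e * (k ∸ i))) (β D (k ∸ i)) ⟩
      (mono (e * i) ⊛ mono (e * (k ∸ i))) ⊛ (α c i ⊛ β D (k ∸ i))    ≈⟨ ⊛-congʳ (α c i ⊛ β D (k ∸ i)) (mono-+ (e * i) (e * (k ∸ i))) ⟩
      mono (e * i + e * (k ∸ i)) ⊛ (α c i ⊛ β D (k ∸ i))             ≈⟨ ⊛-congʳ (α c i ⊛ β D (k ∸ i)) (≈-reflexive (cong mono e*i+e*[k∸i]≡e*k)) ⟩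
      mono (e * k) ⊛ (α c i ⊛ β D (k ∸ i))                           ∎
      where
      open ≈-Reasoning
      e*i+e*[k∸i]≡e*k : e * i + e * (k ∸ i) ≡ e * k
      e*i+e*[k∸i]≡e*k = trans (sym (ℕP.*-distribˡ-+ e i (k ∸ i))) (cong (e *_) (ℕP.m+[n∸m]≡n i≤k))

  private
    predMod : ℕ → ℕ
    predMod zero    = u
    predMod (suc r) = r

  -- the residue of -b modulo t
  negRes : ℕ → ℕ
  negRes zero    = 0
  negRes (suc b) = predMod (negRes b)

  negRes<t : ∀ b → negRes b < t
  negRes<t zero    = s≤s z≤n
  negRes<t (suc b) = predMod<t (negRes<t b)
    where predMod<t : ∀ {r} → r < t → predMod r < t
          predMod<t {zero}  _   = ℕP.n<1+n u
          predMod<t {suc r} r<t = ℕP.<-trans (ℕP.n<1+n r) r<t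

  ∣+negRes : ∀ b → t ∣ b + negRes b
  ∣+negRes zero    = t ∣0
  ∣+negRes (suc b) = step (negRes b) (∣+negRes b)
    where
    step : ∀ r → t ∣ b + r → t ∣ suc b + predMod r
    step zero    t∣b+0 = subst (t ∣_) (identity b u) (∣m∣n⇒∣m+n t∣b+0 (n∣n {t}))
      where identity : ∀ b u → b + 0 + suc u ≡ suc b + u
            identity = ℕSolver.solve-∀
    step (suc r) t∣b+1+r = subst (t ∣_) (ℕP.+-suc b r) t∣b+1+r

  private
    residue-≤-unique : ∀ {b x y} → x ≤ y → y < t → t ∣ b + x → t ∣ b + y → x ≡ y
    residue-≤-unique {b} {x} {y} x≤y y<t t∣b+x t∣b+y with y ∸ x in y∸x≡d
    ... | zero  = ℕP.≤-antisym x≤y (ℕP.m∸n≡0⇒m≤n y∸x≡d)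
    ... | suc d = ⊥-elim (>⇒∤ (ℕP.≤-<-trans (subst (_≤ y) y∸x≡d (ℕP.m∸n≤m y x)) y<t) (subst (t ∣_) y∸x≡d t∣y∸x))
      where
      t∣y∸x : t ∣ y ∸ x
      t∣y∸x = ∣m+n∣m⇒∣n (subst (t ∣_) (sym (trans (ℕP.+-assoc b x (y ∸ x)) (cong (b ℕ.+_) (ℕP.m+[n∸m]≡n x≤y)))) t∣b+y) t∣b+x

  negRes-unique : ∀ {b x} → x < t → t ∣ b + x → negRes b ≡ x
  negRes-unique {b} {x} x<t t∣b+x with ℕP.≤-total x (negRes b)
  ... | inj₁ x≤r = sym (residue-≤-unique x≤r (negRes<t b) t∣b+x (∣+negRes b))
  ... | inj₂ r≤x = residue-≤-unique r≤x x<t (∣+negRes b) t∣b+x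

  negRes-+t : ∀ b → negRes (b + t) ≡ negRes b
  negRes-+t b = negRes-unique (negRes<t b)
    (subst (t ∣_) (xy∙z≈xz∙y b (negRes b) t) (∣m∣n⇒∣m+n (∣+negRes b) (n∣n {t})))

  negRes-∣ : ∀ {b} → t ∣ b → negRes b ≡ 0
  negRes-∣ {b} t∣b = negRes-unique (s≤s z≤n) (subst (t ∣_) (sym (ℕP.+-identityʳ b)) t∣b)

  negRes-∤ : ∀ {b} → ¬ t ∣ b → negRes b ≢ 0
  negRes-∤ {b} t∤b r≡0 = t∤b (subst (t ∣_) (trans (cong (b ℕ.+_) r≡0) (ℕP.+-identityʳ b)) (∣+negRes b))

  ψ : ℕ → ℕ → Series
  ψ k b = zCoeff (negRes b) 0 k

  zCoeff-shift₁ : ∀ r k → zCoeff (suc r) 1 k ≈ mono k ⊛ zCoeff r 0 k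
  zCoeff-shift₁ r k = begin
    zCoeff (suc r) 1 k            ≡⟨ cong (λ c → zCoeff c 1 k) (ℕP.+-comm 1 r) ⟩
    zCoeff (r + 1) (0 + 1) k      ≈⟨ zCoeff-shift r 0 1 k ⟩
    mono (1 * k) ⊛ zCoeff r 0 k   ≡⟨ cong (λ e → mono e ⊛ zCoeff r 0 k) (ℕP.*-identityˡ k) ⟩
    mono k ⊛ zCoeff r 0 k         ∎
    where open ≈-Reasoning

  private
    step-∣ : ∀ k {r} → r ≡ 0 → zCoeff r 0 (suc k) ⊝ mono (suc k) ⊛ zCoeff (predMod r) 0 (suc k) ≈ zeroS
    step-∣ k refl = ⊝-self (≈-trans (zCoeff-cancel 0 (suc k)) (zCoeff-shift₁ u (suc k)))

    step-∤ : ∀ k {r} → r ≢ 0 → zCoeff r 0 (suc k) ⊝ mono (suc k) ⊛ zCoeff (predMod r) 0 (suc k) ≈ zCoeff r 0 k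
    step-∤ k {zero}  r≢0 = ⊥-elim (r≢0 refl)
    step-∤ k {suc r} _   = ≈-trans
      (⊝-swap (zCoeff (suc r) 0 (suc k)) (mono 0 ⊛ zCoeff (suc r) 0 k) (≈-trans (zCoeff-sucD (suc r) 0 k) (zCoeff-shift₁ r (suc k))))
      (mono-zero-⊛ (zCoeff (suc r) 0 k))

  -- one step b ↦ b + 1 is zCoeff-sucD when t ∤ b, and zCoeff-cancel when t ∣ b
  ψ-step : ∀ k b → ψ (suc k) b ⊝ mono (suc k) ⊛ ψ (suc k) (suc b) ≈ unless (t ∣? b) (ψ k b)
  ψ-step k b = by-cases (t ∣? b)
    where
    by-cases : (p : Dec (t ∣ b)) → ψ (suc k) b ⊝ mono (suc k) ⊛ ψ (suc k) (suc b) ≈ unless p (ψ k b)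
    by-cases (yes t∣b) = step-∣ k {negRes b} (negRes-∣ t∣b)
    by-cases (no  t∤b) = step-∤ k {negRes b} (negRes-∤ t∤b)

  ψ-+t : ∀ k b → ψ k (b + t) ≡ ψ k b
  ψ-+t k b = cong (λ r → zCoeff r 0 k) (negRes-+t b)

  ψ-telescope : ∀ k b →
    ψ (suc k) b ⊝ mono (suc k * t) ⊛ ψ (suc k) b ≈ Σs t (λ d → mono (suc k * d) ⊛ unless (t ∣? (b + d)) (ψ k (b + d)))
  ψ-telescope k b = ≈-sym (begin
    Σs t (λ d → mono (suc k * d) ⊛ unless (t ∣? (b + d)) (ψ k (b + d)))   ≈⟨ Σs-cong t (λ {d} _ → ≈-sym (difference d)) ⟩
    Σs t (λ d → T d ⊝ T (suc d))                                           ≈⟨ coeffwise (λ n → sumTo-telescope t (λ d → T d n)) ⟩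
    T 0 ⊝ T t                                                              ≈⟨ ⊝-cong first last ⟩
    ψ (suc k) b ⊝ mono (suc k * t) ⊛ ψ (suc k) b                            ∎)
    where
    open ≈-Reasoning
    T : ℕ → Series
    T d = mono (suc k * d) ⊛ ψ (suc k) (b + d)
    first : T 0 ≈ ψ (suc k) b
    first = ≈-trans (≈-reflexive (cong₂ (λ e x → mono e ⊛ ψ (suc k) x) (ℕP.*-zeroʳ (suc k)) (ℕP.+-identityʳ b)))
                    (mono-zero-⊛ (ψ (suc k) b))
    last : T t ≈ mono (suc k * t) ⊛ ψ (suc k) b
    last = ⊛-congˡ (mono (suc k * t)) (≈-reflexive (ψ-+t (suc k) b))
    difference : ∀ d → T d ⊝ T (suc d) ≈ mono (suc k * d) ⊛ unless (t ∣? (b + d)) (ψ k (b + d))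
    difference d = begin
      T d ⊝ T (suc d)
        ≈⟨ ⊝-cong (≈-refl {T d}) (≈-sym (mono-+-⊛ (suc k * d) (suc k) (ψ (suc k) (b + suc d)) (sym (trans (ℕP.*-suc (suc k) d) (ℕP.+-comm (suc k) (suc k * d)))))) ⟩
      T d ⊝ mono (suc k * d) ⊛ (mono (suc k) ⊛ ψ (suc k) (b + suc d))
        ≈⟨ ⊛-distribˡ-⊝ (mono (suc k * d)) (ψ (suc k) (b + d)) (mono (suc k) ⊛ ψ (suc k) (b + suc d)) ⟨
      mono (suc k * d) ⊛ (ψ (suc k) (b + d) ⊝ mono (suc k) ⊛ ψ (suc k) (b + suc d))
        ≈⟨ ⊛-congˡ (mono (suc k * d)) (≈-reflexive (cong (λ x → ψ (suc k) (b + d) ⊝ mono (suc k) ⊛ ψ (suc k) x) (ℕP.+-suc b d))) ⟩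
      mono (suc k * d) ⊛ (ψ (suc k) (b + d) ⊝ mono (suc k) ⊛ ψ (suc k) (suc (b + d)))
        ≈⟨ ⊛-congˡ (mono (suc k * d)) (ψ-step k (b + d)) ⟩
      mono (suc k * d) ⊛ unless (t ∣? (b + d)) (ψ k (b + d)) ∎

  -- by length-enum, the generating function of the ShiftedFlat b lists of length k
  flatGF : ℕ → ℕ → Series
  flatGF k b = qPoch t t k ⊛ ψ k b

  lastPartTerm : ℕ → ℕ → ℕ → Series
  lastPartTerm k b d = unless (t ∣? (b + d)) (mono (suc k * d) ⊛ flatGF k (b + d))

  flatGF-zero : ∀ b → flatGF 0 b ≈ oneS
  flatGF-zero b = ≈-trans (⊛-identityˡ (ψ 0 b)) (zCoeff-zero (negRes b) 0)

  flatGF-suc : ∀ k b → flatGF (suc k) b ≈ Σs t (lastPartTerm k b)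
  flatGF-suc k b = begin
    (Q ⊛ (oneS ⊝ mono (t + t * k))) ⊛ Ψ   ≈⟨ ⊛-assoc Q (oneS ⊝ mono (t + t * k)) Ψ ⟩
    Q ⊛ ((oneS ⊝ mono (t + t * k)) ⊛ Ψ)   ≈⟨ ⊛-congˡ Q 1-q^e ⟩
    Q ⊛ (Ψ ⊝ mono (suc k * t) ⊛ Ψ)        ≈⟨ ⊛-congˡ Q (ψ-telescope k b) ⟩
    Q ⊛ Σs t (λ d → mono (suc k * d) ⊛ unless (t ∣? (b + d)) (ψ k (b + d)))
      ≈⟨ ⊛-Σs Q t (λ d → mono (suc k * d) ⊛ unless (t ∣? (b + d)) (ψ k (b + d))) ⟩
    Σs t (λ d → Q ⊛ (mono (suc k * d) ⊛ unless (t ∣? (b + d)) (ψ k (b + d))))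
      ≈⟨ Σs-cong t (λ {d} _ → term (suc k * d) (t ∣? (b + d)) (ψ k (b + d))) ⟩
    Σs t (lastPartTerm k b) ∎
    where
    open ≈-Reasoning
    Q = qPoch t t k
    Ψ = ψ (suc k) b
    1-q^e : (oneS ⊝ mono (t + t * k)) ⊛ Ψ ≈ Ψ ⊝ mono (suc k * t) ⊛ Ψ
    1-q^e = ≈-trans (⊛-distribʳ-⊝ Ψ oneS (mono (t + t * k)))
      (⊝-cong (⊛-identityˡ Ψ) (⊛-congʳ Ψ (≈-reflexive (cong mono (trans (sym (ℕP.*-suc t k)) (ℕP.*-comm t (suc k)))))))
    term : ∀ {P : Set} e (p : Dec P) f → Q ⊛ (mono e ⊛ unless p f) ≈ unless p (mono e ⊛ (Q ⊛ f))
    term e p f = ≈-trans (⊛-swap Q (mono e) (unless p f))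
      (≈-trans (⊛-congˡ (mono e) (⊛-unless p Q f)) (⊛-unless p (mono e) (Q ⊛ f)))

  qPoch-invQtQt : ∀ i → qPoch t t i ⊛ invQtQt i ≈ oneS
  qPoch-invQtQt zero    = ⊛-identityˡ oneS
  qPoch-invQtQt (suc i) = begin
    (qPoch t t i ⊛ (oneS ⊝ mono K)) ⊛ (invQtQt i ⊛ geomInv K)    ≈⟨ ⊛-interchange (qPoch t t i) (oneS ⊝ mono K) (invQtQt i) (geomInv K) ⟩
    (qPoch t t i ⊛ invQtQt i) ⊛ ((oneS ⊝ mono K) ⊛ geomInv K)    ≈⟨ ⊛-cong (qPoch-invQtQt i) (≈-trans (⊛-comm (oneS ⊝ mono K) (geomInv K)) (geomInv-inverse (u + t * i))) ⟩
    oneS ⊛ oneS                                                   ≈⟨ ⊛-identityˡ oneS ⟩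
    oneS                                                          ∎
    where
    open ≈-Reasoning
    K = t + t * i

  qPoch-quotient : ∀ {i j} → i ≤ j → qPoch t t j ⊛ invQtQt i ≈ qPoch (suc i * t) t (j ∸ i)
  qPoch-quotient {i} {j} i≤j = begin
    qPoch t t j ⊛ invQtQt i                               ≡⟨ cong (λ n → qPoch t t n ⊛ invQtQt i) (ℕP.m+[n∸m]≡n i≤j) ⟨
    qPoch t t (i + (j ∸ i)) ⊛ invQtQt i                   ≈⟨ ⊛-congʳ (invQtQt i) (qPoch-split t t i (j ∸ i)) ⟩
    (qPoch t t i ⊛ qPoch (t + t * i) t (j ∸ i)) ⊛ invQtQt i ≈⟨ ⊛-congʳ (invQtQt i) (⊛-comm (qPoch t t i) R) ⟩
    (R ⊛ qPoch t t i) ⊛ invQtQt i                         ≈⟨ ⊛-assoc R (qPoch t t i) (invQtQt i) ⟩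
    R ⊛ (qPoch t t i ⊛ invQtQt i)                         ≈⟨ ⊛-congˡ R (qPoch-invQtQt i) ⟩
    R ⊛ oneS                                              ≈⟨ ⊛-identityʳ R ⟩
    R                                                     ≡⟨ cong (λ c → qPoch c t (j ∸ i)) (trans (sym (ℕP.*-suc t i)) (ℕP.*-comm t (suc i))) ⟩
    qPoch (suc i * t) t (j ∸ i)                           ∎
    where
    open ≈-Reasoning
    R = qPoch (t + t * i) t (j ∸ i)

  qPoch-⊛-α-⊛-β : ∀ {i j} → i ≤ j → qPoch t t j ⊛ (α t i ⊛ β 1 (j ∸ i)) ≈ summand t i j
  qPoch-⊛-α-⊛-β {i} {j} i≤j = begin
    Q ⊛ (scaleS σ (mono A ⊛ P) ⊛ (mono (1 * m) ⊛ R))   ≈⟨ ⊛-congˡ Q (scaleS-⊛ˡ σ (mono A ⊛ P) (mono (1 * m) ⊛ R)) ⟩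
    Q ⊛ scaleS σ ((mono A ⊛ P) ⊛ (mono (1 * m) ⊛ R))   ≈⟨ scaleS-⊛ʳ σ Q ((mono A ⊛ P) ⊛ (mono (1 * m) ⊛ R)) ⟩
    scaleS σ (Q ⊛ ((mono A ⊛ P) ⊛ (mono (1 * m) ⊛ R))) ≈⟨ scaleS-cong σ (⊛-congˡ Q (⊛-interchange (mono A) P (mono (1 * m)) R)) ⟩
    scaleS σ (Q ⊛ ((mono A ⊛ mono (1 * m)) ⊛ (P ⊛ R))) ≈⟨ scaleS-cong σ (⊛-congˡ Q (⊛-congʳ (P ⊛ R) (mono-+ A (1 * m)))) ⟩
    scaleS σ (Q ⊛ (mono (A + 1 * m) ⊛ (P ⊛ R)))         ≡⟨ cong (λ e → scaleS σ (Q ⊛ (mono e ⊛ (P ⊛ R)))) A+m≡E ⟩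
    scaleS σ (Q ⊛ (mono E ⊛ (P ⊛ R)))                   ≈⟨ scaleS-cong σ (⊛-swap Q (mono E) (P ⊛ R)) ⟩
    scaleS σ (mono E ⊛ (Q ⊛ (P ⊛ R)))                   ≈⟨ scaleS-cong σ (⊛-congˡ (mono E) (⊛-assoc Q P R)) ⟨
    scaleS σ (mono E ⊛ ((Q ⊛ P) ⊛ R))                   ≈⟨ scaleS-cong σ (⊛-congˡ (mono E) (⊛-congʳ R (qPoch-quotient i≤j))) ⟩
    scaleS σ (mono E ⊛ (Qᵢ ⊛ R))                        ≈⟨ scaleS-cong σ (⊛-assoc (mono E) Qᵢ R) ⟨
    scaleS σ ((mono E ⊛ Qᵢ) ⊛ R)                        ≈⟨ scaleS-⊛ˡ σ (mono E ⊛ Qᵢ) R ⟨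
    scaleS σ (mono E ⊛ Qᵢ) ⊛ R                          ≈⟨ ⊛-congʳ R (scaleS-⊛ˡ σ (mono E) Qᵢ) ⟨
    summand t i j                                       ∎
    where
    open ≈-Reasoning
    Q  = qPoch t t j
    σ  = negOnePow i
    m  = j ∸ i
    A  = (i C 2) * t + t * i
    E  = (suc i C 2) * t + m
    P  = invQtQt i
    R  = invQQ m
    Qᵢ = qPoch (suc i * t) t m
    A+m≡E : A + 1 * m ≡ E
    A+m≡E rewrite C2-suc i = identity (i C 2) i m u
      where identity : ∀ Y i m u → Y * suc u + suc u * i + 1 * m ≡ (i + Y) * suc u + m
            identity = ℕSolver.solve-∀

  flatGF-row : ∀ j → flatGF j 0 ≈ Σs (suc j) (λ i → summand t i j)
  flatGF-row j = begin
    qPoch t t j ⊛ zCoeff 0 0 j                               ≈⟨ ⊛-congˡ (qPoch t t j) (zCoeff-cancel 0 j) ⟩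
    qPoch t t j ⊛ zCoeff t 1 j                               ≈⟨ ⊛-Σs (qPoch t t j) (suc j) (λ i → α t i ⊛ β 1 (j ∸ i)) ⟩
    Σs (suc j) (λ i → qPoch t t j ⊛ (α t i ⊛ β 1 (j ∸ i)))   ≈⟨ Σs-cong (suc j) (λ i<1+j → qPoch-⊛-α-⊛-β (ℕP.≤-pred i<1+j)) ⟩
    Σs (suc j) (λ i → summand t i j)                         ∎
    where open ≈-Reasoning

  ShiftedFlat : ℕ → List ℕ → Set
  ShiftedFlat b ℓ = All (λ x → ¬ t ∣ b + x) ℓ × Linked _≥_ ℓ × Flat t ℓ

  ShiftedFlat-grow⁺ : ∀ {b d ν} → d < t → ¬ t ∣ b + d → ShiftedFlat (b + d) ν → ShiftedFlat b (grow d ν)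
  ShiftedFlat-grow⁺ {b} {d} d<t t∤b+d (regular , decreasing , flat) =
    All-grow⁺ (All.map (λ {y} → subst (λ x → ¬ t ∣ x) (sym (x∙yz≈xz∙y b y d))) regular) t∤b+d ,
    Linked-≥-grow⁺ d decreasing , Flat-grow⁺ flat d<t

  ShiftedFlat-grow⁻ : ∀ {b d} ν → ShiftedFlat b (grow d ν) → d < t × ¬ t ∣ b + d × ShiftedFlat (b + d) ν
  ShiftedFlat-grow⁻ {b} {d} ν (regular , decreasing , flat) =
    let (regularν , t∤b+d) = All-grow⁻ ν regular
        (flatν , d<t)      = Flat-grow⁻ flat
    in d<t , t∤b+d , All.map (λ {y} → subst (λ x → ¬ t ∣ x) (x∙yz≈xz∙y b y d)) regularν , Linked-≥-grow⁻ d decreasing , flatν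

  enum  : ℕ → ℕ → ℕ → List (List ℕ)
  block : ℕ → ℕ → ℕ → ℕ → List (List ℕ)
  enum zero    b zero    = [] ∷ []
  enum zero    b (suc n) = []
  enum (suc k) b n       = concatUpTo (block k b n) t
  block k b n d = unlessL (t ∣? (b + d)) (whenL (suc k * d ℕ.≤? n) (map (grow d) (enum k (b + d) (n ∸ suc k * d))))

  ∈-block⁻ : ∀ k b n d {ℓ} → ℓ ∈ block k b n d →
    ¬ t ∣ b + d × suc k * d ≤ n × ∃[ ν ] (ν ∈ enum k (b + d) (n ∸ suc k * d) × ℓ ≡ grow d ν)
  ∈-block⁻ k b n d ℓ∈ =
    let (t∤b+d , ℓ∈′) = ∈-unlessL⁻ (t ∣? (b + d)) ℓ∈
        (e≤n , ℓ∈″)   = ∈-whenL⁻ (suc k * d ℕ.≤? n) ℓ∈′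
        (ν , ν∈ , ℓ≡) = ∈-map⁻ (grow d) ℓ∈″
    in t∤b+d , e≤n , ν , ν∈ , ℓ≡

  enum-sound : ∀ k b n {ℓ} → ℓ ∈ enum k b n → ShiftedFlat b ℓ × length ℓ ≡ k × sum ℓ ≡ n
  enum-sound zero    b zero    (here refl) = ([] , [] , [] , tt) , refl , refl
  enum-sound (suc k) b n ℓ∈ with ∈-concatUpTo⁻ (block k b n) t ℓ∈
  ... | d , d<t , ℓ∈block with ∈-block⁻ k b n d ℓ∈block
  ...   | t∤b+d , e≤n , ν , ν∈ , refl =
    let (flatν , lenν , sumν) = enum-sound k (b + d) (n ∸ suc k * d) ν∈
    in ShiftedFlat-grow⁺ d<t t∤b+d flatν ,
       trans (length-grow d ν) (cong suc lenν) ,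
       trans (sum-grow d ν) (trans (cong₂ (λ l s → suc l * d + s) lenν sumν) (ℕP.m+[n∸m]≡n e≤n))

  enum-complete : ∀ k b n {ℓ} → ShiftedFlat b ℓ → length ℓ ≡ k → sum ℓ ≡ n → ℓ ∈ enum k b n
  enum-complete zero    b n {[]}    _    _   refl = here refl
  enum-complete (suc k) b n {x ∷ r} flat len sum≡n =
    ∈-concatUpTo⁺ (block k b n) d<t
      (∈-unlessL⁺ (t ∣? (b + d)) t∤b+d (∈-whenL⁺ (suc k * d ℕ.≤? n) e≤n
        (subst (_∈ map (grow d) (enum k (b + d) (n ∸ suc k * d))) (sym ℓ≡)
          (∈-map⁺ (grow d) (enum-complete k (b + d) (n ∸ suc k * d) flatν lenν sumν)))))
    where
    d = lastPart (x ∷ r)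
    ν = lower d (x ∷ r)
    ℓ≡ : x ∷ r ≡ grow d ν
    ℓ≡ = grow-lower (proj₁ (proj₂ flat))
    split = ShiftedFlat-grow⁻ ν (subst (ShiftedFlat b) ℓ≡ flat)
    d<t   = proj₁ split
    t∤b+d = proj₁ (proj₂ split)
    flatν = proj₂ (proj₂ split)
    lenν : length ν ≡ k
    lenν = ℕP.suc-injective (trans (sym (length-grow d ν)) (trans (cong length (sym ℓ≡)) len))
    total : suc k * d + sum ν ≡ n
    total = trans (cong (λ l → suc l * d + sum ν) (sym lenν)) (trans (sym (sum-grow d ν)) (trans (cong sum (sym ℓ≡)) sum≡n))
    e≤n : suc k * d ≤ n
    e≤n = subst (suc k * d ≤_) total (ℕP.m≤m+n (suc k * d) (sum ν))
    sumν : sum ν ≡ n ∸ suc k * d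
    sumν = trans (sym (ℕP.m+n∸m≡n (suc k * d) (sum ν))) (cong (_∸ suc k * d) total)

  enum-unique : ∀ k b n → Unique (enum k b n)
  enum-unique zero    b zero    = [] ∷ []
  enum-unique zero    b (suc n) = []
  enum-unique (suc k) b n = concatUpTo-unique (block k b n) lastPart labelled unique t
    where
    labelled : ∀ {d ℓ} → ℓ ∈ block k b n d → lastPart ℓ ≡ d
    labelled {d} ℓ∈ with ∈-block⁻ k b n d ℓ∈
    ... | _ , _ , ν , _ , refl = lastPart-grow d ν
    unique : ∀ d → Unique (block k b n d)
    unique d = unlessL-unique (t ∣? (b + d)) (whenL-unique (suc k * d ℕ.≤? n)
      (Unique.map⁺ (grow-injective d) (enum-unique k (b + d) (n ∸ suc k * d))))

  length-enum : ∀ k b n → + length (enum k b n) ≡ flatGF k b n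
  length-enum zero    b n = trans (empty-list n) (sym (coeff (flatGF-zero b) n))
    where empty-list : ∀ n → + length (enum 0 b n) ≡ oneS n
          empty-list zero    = refl
          empty-list (suc n) = refl
  length-enum (suc k) b n = begin
    + length (concatUpTo (block k b n) t)              ≡⟨ length-concatUpTo (block k b n) t ⟩
    sumTo t (λ d → + length (block k b n d))           ≡⟨ sumTo-cong t (λ {d} _ → length-block d) ⟩
    Σs t (lastPartTerm k b) n                          ≡⟨ coeff (flatGF-suc k b) n ⟨
    flatGF (suc k) b n                                 ∎
    where
    open ≡-Reasoning
    length-block : ∀ d → + length (block k b n d) ≡ lastPartTerm k b d n
    length-block d = length-unlessL (t ∣? (b + d)) (length-whenL-mono (suc k * d ℕ.≤? n) {F = flatGF k (b + d)}
      (trans (cong +_ (ListP.length-map (grow d) (enum k (b + d) (n ∸ suc k * d)))) (length-enum k (b + d) (n ∸ suc k * d))))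

  private
    ∤⇒positive : ∀ {x} → ¬ t ∣ x → 1 ≤ x
    ∤⇒positive {zero}  t∤0 = ⊥-elim (t∤0 (t ∣0))
    ∤⇒positive {suc x} _   = s≤s z≤n

  partitionsUpTo : ℕ → ℕ → List (List ℕ)
  partitionsUpTo n = concatUpTo (λ j → enum j 0 n)

  ∈-partitionsUpTo⁻ : ∀ n J {ℓ} → ℓ ∈ partitionsUpTo n J → RegularFlatPartition t n ℓ
  ∈-partitionsUpTo⁻ n J ℓ∈ with ∈-concatUpTo⁻ (λ j → enum j 0 n) J ℓ∈
  ... | j , _ , ℓ∈enum with enum-sound j 0 n ℓ∈enum
  ...   | (regular , decreasing , flat) , _ , sum≡n = (sum≡n , All.map ∤⇒positive regular , decreasing) , regular , flat

  ∈-partitionsUpTo⁺ : ∀ n J {ℓ} → RegularFlatPartition t n ℓ → length ℓ < J → ℓ ∈ partitionsUpTo n J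
  ∈-partitionsUpTo⁺ n J ((sum≡n , _ , decreasing) , regular , flat) ℓ<J =
    ∈-concatUpTo⁺ (λ j → enum j 0 n) ℓ<J (enum-complete _ 0 n (regular , decreasing , flat) refl sum≡n)

  partitionsUpTo-unique : ∀ n J → Unique (partitionsUpTo n J)
  partitionsUpTo-unique n = concatUpTo-unique (λ j → enum j 0 n) length
    (λ {j} ℓ∈ → proj₁ (proj₂ (enum-sound j 0 n ℓ∈))) (λ j → enum-unique j 0 n)

  length-partitionsUpTo : ∀ n M → + length (partitionsUpTo n (suc M)) ≡ rhsPartial t M n
  length-partitionsUpTo n M = trans (length-concatUpTo (λ j → enum j 0 n) (suc M))
    (sumTo-cong (suc M) (λ {j} _ → trans (length-enum j 0 n) (coeff (flatGF-row j) n)))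

theorem9 : (t : ℕ) → 2 ≤ t → (n : ℕ) →
  ∃[ N ] ((M : ℕ) → N ≤ M →
    ∃[ L ] (Unique L ×
            ((ℓ : List ℕ) → (ℓ ∈ L) ⇔ RegularFlatPartition t n ℓ) ×
            (rhsPartial t M n ≡ + (length L))))
-- only t ≠ 0 is needed: for t = 1 both sides count just the empty partition
theorem9 zero    ()
theorem9 (suc u) _ n = n , λ M n≤M →
  partitionsUpTo u n (suc M) ,
  partitionsUpTo-unique u n (suc M) ,
  (λ ℓ → mk⇔ (∈-partitionsUpTo⁻ u n (suc M))
             (λ partition@((sum≡n , positive , _) , _) →
                ∈-partitionsUpTo⁺ u n (suc M) partition
                  (s≤s (ℕP.≤-trans (length≤sum positive) (subst (_≤ M) (sym sum≡n) n≤M))))) ,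
  sym (length-partitionsUpTo u n M)
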